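{- Let $S=\{s_1,\dots,s_n\}$, let $\mathcal{C}=\{C_1,\dots,C_k\}$ be linearly ordered by $\sigma$ with $C_1\prec_\sigma\dots\prec_\sigma C_k$, let $m\ge1$ and let $\mathcal{T}=\{(t_0,\dots,t_m): t_0,\dots,t_m:S\to\mathcal{C}\}$ be the set of all sequences of $m+1$ tests. Write $n=xk+y$ with integers $x\ge0$, $0\le y<k$. Then $$ecr(S,\mathcal{C},\mathcal{T},\sigma)=\tfrac{m}{2}\bigl(kx(n-x)+y(n-2x-1)\bigr),$$ and this maximum is achieved by a sequence of tests such that, writing $a_i(t_j)=|\{s: t_j(s)=C_i\}|$, at every test $k-y$ categories contain $x$ subjects and $y$ categories contain $x+1$ subjects, and $a_i(t_j)=a_{k-i+1}(t_{j+1})$ for all $i=1,\dots,k$ and $j=0,\dots,m-1$.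
   Context: For an ordinal panel data instance with tests $t_0,\dots,t_m:S\to\mathcal{C}$, a combinatorial layout is a sequence of linear orders $\pi_0,\dots,\pi_m$ of $S$ such that $t_j(s)\prec_\sigma t_j(s')$ implies $s$ precedes $s'$ in $\pi_j$. Its number of crossings is the number of pairs $(j,\{s,s'\})$, $0\le j\le m-1$, such that the relative order of $s,s'$ in $\pi_j$ differs from that in $\pi_{j+1}$. The panel crossing number $pcr(S,\mathcal{C},T,\sigma)$ is the minimum number of crossings over all combinatorial layouts, and $ecr(S,\mathcal{C},\mathcal{T},\sigma)=\max\{pcr(S,\mathcal{C},T,\sigma):T\in\mathcal{T}\}$. -}

module Defs where

open import Data.Nat using (ℕ; zero; suc; _+_; _*_; _∸_; _≤_; _<_)
open import Data.Nat.Base using (_<ᵇ_; _≡ᵇ_)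
open import Data.Bool using (Bool; true; false; if_then_else_; _xor_; _∧_)
open import Data.Fin using (Fin; toℕ; inject₁; opposite)
import Data.Fin as F
open import Data.Product using (Σ; _×_; _,_; ∃; ∃-syntax)
open import Relation.Binary.PropositionalEquality using (_≡_)
open import Function.Definitions using (Injective)

count : ∀ {n} → (Fin n → Bool) → ℕ
count {zero}  p = 0
count {suc n} p = (if p F.zero then 1 else 0) + count (λ i → p (F.suc i))

sumFin : ∀ {n} → (Fin n → ℕ) → ℕ
sumFin {zero}  f = 0
sumFin {suc n} f = f F.zero + sumFin (λ i → f (F.suc i))

_<ᶠ_ : ∀ {n} → Fin n → Fin n → Bool
a <ᶠ b = toℕ a <ᵇ toℕ b

-- Subjects S = Fin n, categories C = Fin k ordered by the natural order
-- (C_1 ≺ ... ≺ C_k is Fin k's order), a sequence of m+1 tests t_0..t_m.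
Tests : ℕ → ℕ → ℕ → Set
Tests n k m = Fin (suc m) → Fin n → Fin k

-- A linear order on S = Fin n, represented by an injective position map
-- (s precedes s' iff pos s < pos s').
LinOrder : ℕ → Set
LinOrder n = Σ (Fin n → Fin n) (Injective _≡_ _≡_)

pos : ∀ {n} → LinOrder n → Fin n → Fin n
pos (f , _) = f

Layout : ∀ {n k m} → Tests n k m → Set
Layout {n} {k} {m} t =
  Σ (Fin (suc m) → LinOrder n) λ π →
    ∀ j s s' → toℕ (t j s) < toℕ (t j s') → toℕ (pos (π j) s) < toℕ (pos (π j) s')

crossings : ∀ {n k m} {t : Tests n k m} → Layout t → ℕ
crossings {n} {k} {m} (π , _) =
  sumFin {m} λ j →
    sumFin {n} λ s →
      count {n} λ s' →
        (s <ᶠ s') ∧ ((pos (π (inject₁ j)) s <ᶠ pos (π (inject₁ j)) s')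
                      xor (pos (π (F.suc j)) s <ᶠ pos (π (F.suc j)) s'))

IsPcr : ∀ {n k m} → Tests n k m → ℕ → Set
IsPcr t c = (Σ (Layout t) λ L → crossings L ≡ c) × (∀ (L : Layout t) → c ≤ crossings L)

IsEcr : ℕ → ℕ → ℕ → ℕ → Set
IsEcr n k m e =
  (Σ (Tests n k m) λ t → IsPcr t e) × (∀ (t : Tests n k m) c → IsPcr t c → c ≤ e)

occ : ∀ {n k m} → Tests n k m → Fin (suc m) → Fin k → ℕ
occ {n} t j i = count {n} λ s → toℕ (t j s) ≡ᵇ toℕ i

Balanced : ∀ {n k m} → Tests n k m → ℕ → ℕ → Set
Balanced {n} {k} {m} t x y =
  ∀ j → (count {k} (λ i → occ t j i ≡ᵇ x) ≡ k ∸ y)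
      × (count {k} (λ i → occ t j i ≡ᵇ suc x) ≡ y)

Reflected : ∀ {n k m} → Tests n k m → Set
Reflected {n} {k} {m} t =
  ∀ (j : Fin m) (i : Fin k) → occ t (inject₁ j) i ≡ occ t (F.suc j) (opposite i)

-- Write sep g for the number of pairs of subjects that g puts in different categories.
-- Between tests j and j+1 a layout only has to swap pairs separated by test j+1: ranking
-- each test by category and breaking ties by the previous positions does exactly that, so
-- pcr ≤ Σⱼ sep tⱼ₊₁. If each test reverses the category order of the previous one, every
-- layout must swap all these pairs, so the bound is attained. Finally
-- 2 sep g = n² − Σᵢ aᵢ², and (a − x)(a − x − 1) ≥ 0 gives Σᵢ aᵢ² ≥ k x² + y (2x + 1) with
-- equality for balanced class sizes; so alternating a balanced colouring with its reverse
-- is extremal.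

module Submission where

open import Defs
open import Data.Bool using (Bool; true; false; not; _∧_; _xor_; if_then_else_; T)
open import Data.Empty using (⊥-elim)
open import Data.Fin using (Fin; toℕ; inject₁; opposite; fromℕ<; splitAt; _↑ˡ_; _↑ʳ_; inject≤)
  renaming (zero to fzero; suc to fsuc)
open import Data.Fin.Permutation using (reverse)
open import Data.Fin.Properties
  using (toℕ-injective; toℕ<n; toℕ-fromℕ<; toℕ-inject₁; toℕ-inject≤; opposite-prop; opposite-involutive;
         splitAt-↑ˡ; splitAt-↑ʳ)
open import Data.List using (_∷_; [])
open import Data.Nat using (ℕ; zero; suc; _+_; _*_; _∸_; _≤_; _<_; z≤n; s≤s)
open import Data.Nat.Base using (_<ᵇ_; _≡ᵇ_)
open import Data.Nat.Properties
open import Algebra.Properties.CommutativeMonoid.Sum +-0-commutativeMonoid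
  using (sum; sum-cong-≗; sum-replicate-zero; ∑-distrib-+; ∑-comm; sum-permute)
open import Algebra.Properties.CommutativeSemigroup *-commutativeSemigroup using (x∙yz≈y∙xz)
open import Algebra.Properties.Semiring.Sum +-*-semiring using (*-distribˡ-sum; *-distribʳ-sum)
open import Data.Nat.Tactic.RingSolver using (solve)
open import Data.Product using (Σ; _×_; _,_; proj₁; proj₂; ∃-syntax)
open import Data.Sum using (inj₁; inj₂; [_,_]′)
open import Function using (_∘_; id; _⇔_; mk⇔; Equivalence)
open import Function.Definitions using (Injective)
open import Relation.Binary using (tri<; tri≈; tri>)
open import Relation.Binary.PropositionalEquality hiding ([_])
open import Relation.Nullary using (¬_; contradiction)
open import Relation.Nullary.Reflects using (Reflects; ofʸ; ofⁿ; det; fromEquivalence)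

<ᵇ-cong : ∀ {a b c d} → (a < b → c < d) → (c < d → a < b) → (a <ᵇ b) ≡ (c <ᵇ d)
<ᵇ-cong {a} {b} {c} {d} to from =
  det (<ᵇ-reflects-< a b) (fromEquivalence (from ∘ <ᵇ⇒< c d) (<⇒<ᵇ ∘ to))

<ᵇ-true : ∀ {m n} → m < n → (m <ᵇ n) ≡ true
<ᵇ-true {m} {n} m<n = det (<ᵇ-reflects-< m n) (ofʸ m<n)

<ᵇ-false : ∀ {m n} → n ≤ m → (m <ᵇ n) ≡ false
<ᵇ-false {m} {n} n≤m = det (<ᵇ-reflects-< m n) (ofⁿ (≤⇒≯ n≤m))

≡ᵇ-reflects-≡ : ∀ m n → Reflects (m ≡ n) (m ≡ᵇ n)
≡ᵇ-reflects-≡ m n = fromEquivalence (≡ᵇ⇒≡ m n) (≡⇒≡ᵇ m n)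

≡ᵇ-sym : ∀ m n → (m ≡ᵇ n) ≡ (n ≡ᵇ m)
≡ᵇ-sym m n = det (≡ᵇ-reflects-≡ m n) (fromEquivalence (sym ∘ ≡ᵇ⇒≡ n m) (≡⇒≡ᵇ n m ∘ sym))

T-not-≡ᵇ : ∀ {m n} → T (not (m ≡ᵇ n)) ⇔ (m ≢ n)
T-not-≡ᵇ {m} {n} with m ≡ᵇ n | ≡ᵇ-reflects-≡ m n
... | true  | ofʸ m≡n = mk⇔ (λ ()) (λ m≢n → m≢n m≡n)
... | false | ofⁿ m≢n = mk⇔ (λ _ → m≢n) _

T-xor : ∀ {x y} → T (x xor y) ⇔ (x ≢ y)
T-xor {false} {false} = mk⇔ (λ ()) (λ x≢y → x≢y refl)
T-xor {false} {true}  = mk⇔ (λ _ ()) _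
T-xor {true}  {false} = mk⇔ (λ _ ()) _
T-xor {true}  {true}  = mk⇔ (λ ()) (λ x≢y → x≢y refl)

∧-monoʳ-T : ∀ a {b c} → (T b → T c) → T (a ∧ b) → T (a ∧ c)
∧-monoʳ-T true b⇒c = b⇒c

sumFin≡sum : ∀ {n} (f : Fin n → ℕ) → sumFin f ≡ sum f
sumFin≡sum {zero}  f = refl
sumFin≡sum {suc n} f = cong (f fzero +_) (sumFin≡sum (f ∘ fsuc))

sum-mono-≤ : ∀ {n} {f g : Fin n → ℕ} → (∀ i → f i ≤ g i) → sum f ≤ sum g
sum-mono-≤ {zero}  f≤g = z≤n
sum-mono-≤ {suc n} f≤g = +-mono-≤ (f≤g fzero) (sum-mono-≤ (f≤g ∘ fsuc))

sum-const : ∀ n c → sum {n} (λ _ → c) ≡ n * c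
sum-const zero    c = refl
sum-const (suc n) c = cong (c +_) (sum-const n c)

[_] : Bool → ℕ
[ b ] = if b then 1 else 0

count≡sum : ∀ {n} (p : Fin n → Bool) → count p ≡ sum (λ i → [ p i ])
count≡sum {zero}  p = refl
count≡sum {suc n} p = cong ([ p fzero ] +_) (count≡sum (p ∘ fsuc))

count-cong : ∀ {n} {p q : Fin n → Bool} → (∀ i → p i ≡ q i) → count p ≡ count q
count-cong {zero}  p≗q = refl
count-cong {suc n} p≗q = cong₂ _+_ (cong [_] (p≗q fzero)) (count-cong (p≗q ∘ fsuc))

[]-mono : ∀ {a b} → (T a → T b) → [ a ] ≤ [ b ]
[]-mono {false}         a⇒b = z≤n
[]-mono {true}  {true}  a⇒b = ≤-refl
[]-mono {true}  {false} a⇒b = ⊥-elim (a⇒b _)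

count-mono : ∀ {n} {p q : Fin n → Bool} → (∀ i → T (p i) → T (q i)) → count p ≤ count q
count-mono {zero}  p⇒q = z≤n
count-mono {suc n} p⇒q = +-mono-≤ ([]-mono (p⇒q fzero)) (count-mono (p⇒q ∘ fsuc))

count-mono-< : ∀ {n} {p q : Fin n → Bool} (a : Fin n) → (∀ i → T (p i) → T (q i)) →
  p a ≡ false → q a ≡ true → count p < count q
count-mono-< fzero p⇒q pa qa rewrite pa | qa = s≤s (count-mono (p⇒q ∘ fsuc))
count-mono-< (fsuc a) p⇒q pa qa =
  +-mono-≤-< ([]-mono (p⇒q fzero)) (count-mono-< a (p⇒q ∘ fsuc) pa qa)

count-true : ∀ n → count {n} (λ _ → true) ≡ n
count-true zero    = refl
count-true (suc n) = cong suc (count-true n)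

count-false : ∀ n → count {n} (λ _ → false) ≡ 0
count-false zero    = refl
count-false (suc n) = count-false n

count-complement : ∀ {n} (p : Fin n → Bool) → count p + count (not ∘ p) ≡ n
count-complement {zero}  p = refl
count-complement {suc n} p with p fzero
... | true  = cong suc (count-complement (p ∘ fsuc))
... | false = trans (+-suc _ _) (cong suc (count-complement (p ∘ fsuc)))

count-opposite : ∀ {n} (p : Fin n → Bool) → count (p ∘ opposite) ≡ count p
count-opposite p = begin
  count (p ∘ opposite)            ≡⟨ count≡sum (p ∘ opposite) ⟩
  sum (λ i → [ p (opposite i) ])  ≡⟨ sum-permute (λ i → [ p i ]) reverse ⟨
  sum (λ i → [ p i ])             ≡⟨ count≡sum p ⟨
  count p                         ∎
  where open ≡-Reasoning

count-↑ : ∀ a {b} (p : Fin (a + b) → Bool) →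
  count p ≡ count (λ i → p (i ↑ˡ b)) + count (λ j → p (a ↑ʳ j))
count-↑ zero    p = refl
count-↑ (suc a) p = trans (cong ([ p fzero ] +_) (count-↑ a (p ∘ fsuc))) (sym (+-assoc [ p fzero ] _ _))

count-toℕ≡ : ∀ y c → count {y} (λ r → toℕ r ≡ᵇ c) ≡ [ c <ᵇ y ]
count-toℕ≡ zero    c       = refl
count-toℕ≡ (suc y) zero    = cong suc (count-false y)
count-toℕ≡ (suc y) (suc c) = count-toℕ≡ y c

count-toℕ< : ∀ {k} y → y ≤ k → count {k} (λ i → toℕ i <ᵇ y) ≡ y
count-toℕ< {k}     zero    _         = count-false k
count-toℕ< {suc k} (suc y) (s≤s y≤k) = cong suc (count-toℕ< y y≤k)

module _ {n : ℕ} (key : Fin n → ℕ) where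

  rank-bound : ∀ a → count (λ s → key s <ᵇ key a) < n
  rank-bound a = subst (count (λ s → key s <ᵇ key a) <_) (count-true n)
    (count-mono-< a (λ _ _ → _) (<ᵇ-false {key a} ≤-refl) refl)

  rank : Fin n → Fin n
  rank a = fromℕ< (rank-bound a)

  rank-mono-< : ∀ {a b} → key a < key b → toℕ (rank a) < toℕ (rank b)
  rank-mono-< {a} {b} ka<kb =
    subst₂ _<_ (sym (toℕ-fromℕ< (rank-bound a))) (sym (toℕ-fromℕ< (rank-bound b)))
      (count-mono-< a (λ s ks<ka → <⇒<ᵇ (<-trans (<ᵇ⇒< _ _ ks<ka) ka<kb))
        (<ᵇ-false {key a} ≤-refl) (<ᵇ-true ka<kb))

  module _ (key-injective : Injective _≡_ _≡_ key) where

    rank-cancel-< : ∀ {a b} → toℕ (rank a) < toℕ (rank b) → key a < key b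
    rank-cancel-< {a} {b} ra<rb with <-cmp (key a) (key b)
    ... | tri< ka<kb _ _ = ka<kb
    ... | tri≈ _ ka≡kb _ = contradiction (cong (toℕ ∘ rank) (key-injective ka≡kb)) (<⇒≢ ra<rb)
    ... | tri> _ _ kb<ka = contradiction (rank-mono-< kb<ka) (<⇒≯ ra<rb)

    rank-<ᵇ : ∀ a b → (toℕ (rank a) <ᵇ toℕ (rank b)) ≡ (key a <ᵇ key b)
    rank-<ᵇ a b = <ᵇ-cong rank-cancel-< rank-mono-<

    rank-injective : Injective _≡_ _≡_ rank
    rank-injective {a} {b} ra≡rb = key-injective (≤-antisym (≮⇒≥ kb≮ka) (≮⇒≥ ka≮kb))
      where
      kb≮ka : ¬ (key b < key a)
      kb≮ka kb<ka = <-irrefl (cong toℕ (sym ra≡rb)) (rank-mono-< kb<ka)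
      ka≮kb : ¬ (key a < key b)
      ka≮kb ka<kb = <-irrefl (cong toℕ ra≡rb) (rank-mono-< ka<kb)

module _ {n k : ℕ} (g : Fin n → Fin k) (p : Fin n → Fin n) where

  -- ties in g are broken by p, because toℕ (p s) < n
  refineKey : Fin n → ℕ
  refineKey s = toℕ (g s) * n + toℕ (p s)

  refineKey-mono-< : ∀ {a b} → toℕ (g a) < toℕ (g b) → refineKey a < refineKey b
  refineKey-mono-< {a} {b} ga<gb = begin-strict
    toℕ (g a) * n + toℕ (p a)  <⟨ +-monoʳ-< (toℕ (g a) * n) (toℕ<n (p a)) ⟩
    toℕ (g a) * n + n          ≡⟨ +-comm (toℕ (g a) * n) n ⟩
    suc (toℕ (g a)) * n        ≤⟨ *-monoˡ-≤ n ga<gb ⟩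
    toℕ (g b) * n              ≤⟨ m≤m+n (toℕ (g b) * n) (toℕ (p b)) ⟩
    refineKey b                ∎
    where open ≤-Reasoning

  refineKey-tie : ∀ {a b} → toℕ (g a) ≡ toℕ (g b) →
    (refineKey a <ᵇ refineKey b) ≡ (toℕ (p a) <ᵇ toℕ (p b))
  refineKey-tie {a} {b} ga≡gb rewrite ga≡gb =
    <ᵇ-cong (+-cancelˡ-< (toℕ (g b) * n) _ _) (+-monoʳ-< (toℕ (g b) * n))

  refineKey-injective : Injective _≡_ _≡_ p → Injective _≡_ _≡_ refineKey
  refineKey-injective p-injective {a} {b} ka≡kb with <-cmp (toℕ (g a)) (toℕ (g b))
  ... | tri< ga<gb _ _ = contradiction ka≡kb (<⇒≢ (refineKey-mono-< ga<gb))
  ... | tri> _ _ gb<ga = contradiction (sym ka≡kb) (<⇒≢ (refineKey-mono-< gb<ga))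
  ... | tri≈ _ ga≡gb _ rewrite ga≡gb =
    p-injective (toℕ-injective (+-cancelˡ-≡ (toℕ (g b) * n) _ _ ka≡kb))

  refine : Fin n → Fin n
  refine = rank refineKey

  refine-mono-< : ∀ {a b} → toℕ (g a) < toℕ (g b) → toℕ (refine a) < toℕ (refine b)
  refine-mono-< = rank-mono-< refineKey ∘ refineKey-mono-<

  module _ (p-injective : Injective _≡_ _≡_ p) where

    refine-injective : Injective _≡_ _≡_ refine
    refine-injective = rank-injective refineKey (refineKey-injective p-injective)

    refine-tie : ∀ {a b} → toℕ (g a) ≡ toℕ (g b) →
      (toℕ (refine a) <ᵇ toℕ (refine b)) ≡ (toℕ (p a) <ᵇ toℕ (p b))
    refine-tie {a} {b} ga≡gb =
      trans (rank-<ᵇ refineKey (refineKey-injective p-injective) a b) (refineKey-tie ga≡gb)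

module _ {n k : ℕ} where

  greedyFrom : ∀ {m} → (Fin n → Fin n) → (Fin (suc m) → Fin n → Fin k) →
    Fin (suc m) → Fin n → Fin n
  greedyFrom         p t fzero    = refine (t fzero) p
  greedyFrom {suc m} p t (fsuc j) = greedyFrom (refine (t fzero) p) (t ∘ fsuc) j

  greedyFrom-injective : ∀ {m p} (t : Fin (suc m) → Fin n → Fin k) →
    Injective _≡_ _≡_ p → ∀ j → Injective _≡_ _≡_ (greedyFrom p t j)
  greedyFrom-injective t p-inj fzero = refine-injective (t fzero) _ p-inj
  greedyFrom-injective {suc m} t p-inj (fsuc j) =
    greedyFrom-injective (t ∘ fsuc) (refine-injective (t fzero) _ p-inj) j

  greedyFrom-mono-< : ∀ {m} p (t : Fin (suc m) → Fin n → Fin k) j {a b} →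
    toℕ (t j a) < toℕ (t j b) → toℕ (greedyFrom p t j a) < toℕ (greedyFrom p t j b)
  greedyFrom-mono-< p t fzero = refine-mono-< (t fzero) p
  greedyFrom-mono-< {suc m} p t (fsuc j) = greedyFrom-mono-< (refine (t fzero) p) (t ∘ fsuc) j

  greedyFrom-suc : ∀ {m} p (t : Fin (suc m) → Fin n → Fin k) (j : Fin m) →
    greedyFrom p t (fsuc j) ≡ refine (t (fsuc j)) (greedyFrom p t (inject₁ j))
  greedyFrom-suc p t fzero    = refl
  greedyFrom-suc p t (fsuc j) = greedyFrom-suc (refine (t fzero) p) (t ∘ fsuc) j

greedy : ∀ {n k m} (t : Tests n k m) → Layout t
greedy t = (λ j → greedyFrom id t j , greedyFrom-injective t id j) , λ j _ _ → greedyFrom-mono-< id t j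

separatedPairs : ∀ {n k} → (Fin n → Fin k) → ℕ
separatedPairs g = sum λ s → count λ s' → (s <ᶠ s') ∧ not (toℕ (g s) ≡ᵇ toℕ (g s'))

module _ {n k m} {t : Tests n k m} (L : Layout t) where

  precedes : Fin (suc m) → Fin n → Fin n → Bool
  precedes j a b = toℕ (pos (proj₁ L j) a) <ᵇ toℕ (pos (proj₁ L j) b)

  precedes-true : ∀ {j a b} → toℕ (t j a) < toℕ (t j b) → precedes j a b ≡ true
  precedes-true {j} {a} {b} lt = <ᵇ-true (proj₂ L j a b lt)

  precedes-false : ∀ {j a b} → toℕ (t j b) < toℕ (t j a) → precedes j a b ≡ false
  precedes-false {j} {a} {b} lt = <ᵇ-false (<⇒≤ (proj₂ L j b a lt))

  crossesAt : Fin m → Fin n → Fin n → Bool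
  crossesAt j s s' = (s <ᶠ s') ∧ (precedes (inject₁ j) s s' xor precedes (fsuc j) s s')

  crossings≡sum : crossings L ≡ sum λ j → sum λ s → count (crossesAt j s)
  crossings≡sum = trans (sumFin≡sum λ j → sumFin λ s → count (crossesAt j s))
                        (sum-cong-≗ λ j → sumFin≡sum λ s → count (crossesAt j s))

  crossings-≤ : (g : Fin m → Fin n → Fin k) →
    (∀ j a b → toℕ (g j a) ≡ toℕ (g j b) → precedes (inject₁ j) a b ≡ precedes (fsuc j) a b) →
    crossings L ≤ sum (λ j → separatedPairs (g j))
  crossings-≤ g tie-kept = subst (_≤ _) (sym crossings≡sum)
    (sum-mono-≤ λ j → sum-mono-≤ λ a → count-mono λ b → ∧-monoʳ-T (a <ᶠ b) λ crossed →
      Equivalence.from T-not-≡ᵇ (Equivalence.to T-xor crossed ∘ tie-kept j a b))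

  crossings-≥ : (g : Fin m → Fin n → Fin k) →
    (∀ j a b → toℕ (g j a) ≢ toℕ (g j b) → precedes (inject₁ j) a b ≢ precedes (fsuc j) a b) →
    sum (λ j → separatedPairs (g j)) ≤ crossings L
  crossings-≥ g split-crossed = subst (_ ≤_) (sym crossings≡sum)
    (sum-mono-≤ λ j → sum-mono-≤ λ a → count-mono λ b → ∧-monoʳ-T (a <ᶠ b) λ split →
      Equivalence.from T-xor (split-crossed j a b (Equivalence.to T-not-≡ᵇ split)))

greedy-crossings-≤ : ∀ {n k m} (t : Tests n k m) →
  crossings (greedy t) ≤ sum (λ j → separatedPairs (t (fsuc j)))
greedy-crossings-≤ t = crossings-≤ (greedy t) (t ∘ fsuc) λ j a b tie →
  sym (trans (cong (λ π → toℕ (π a) <ᵇ toℕ (π b)) (greedyFrom-suc id t j))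
             (refine-tie (t (fsuc j)) _ (greedyFrom-injective t id (inject₁ j)) tie))

opposite-reverses-< : ∀ {k} {a b : Fin k} → toℕ a < toℕ b → toℕ (opposite b) < toℕ (opposite a)
opposite-reverses-< {k} {a} {b} a<b rewrite opposite-prop a | opposite-prop b =
  ∸-monoʳ-< (s≤s a<b) (toℕ<n b)

Reversing : ∀ {n k m} → Tests n k m → Set
Reversing t = ∀ j s → t (fsuc j) s ≡ opposite (t (inject₁ j) s)

reversing-crossings-≥ : ∀ {n k m} {t : Tests n k m} → Reversing t → (L : Layout t) →
  sum (λ j → separatedPairs (t (fsuc j))) ≤ crossings L
reversing-crossings-≥ {t = t} reversing L = crossings-≥ L (t ∘ fsuc) crossed
  where
  reversed-< : ∀ j {a b} → toℕ (t (inject₁ j) a) < toℕ (t (inject₁ j) b) →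
    toℕ (t (fsuc j) b) < toℕ (t (fsuc j) a)
  reversed-< j {a} {b} lt rewrite reversing j a | reversing j b = opposite-reverses-< lt

  crossed : ∀ j a b → toℕ (t (fsuc j) a) ≢ toℕ (t (fsuc j) b) →
    precedes L (inject₁ j) a b ≢ precedes L (fsuc j) a b
  crossed j a b split with <-cmp (toℕ (t (inject₁ j) a)) (toℕ (t (inject₁ j) b))
  ... | tri< lt _ _ rewrite precedes-true L lt | precedes-false L (reversed-< j lt) = λ ()
  ... | tri> _ _ gt rewrite precedes-false L gt | precedes-true L (reversed-< j gt) = λ ()
  ... | tri≈ _ eq _ = contradiction
    (cong toℕ (trans (reversing j a) (trans (cong opposite (toℕ-injective eq)) (sym (reversing j b)))))
    split

classSize : ∀ {n k} → (Fin n → Fin k) → Fin k → ℕ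
classSize g i = count λ s → toℕ (g s) ≡ᵇ toℕ i

sum-indicator : ∀ {k} (c : Fin k) (h : Fin k → ℕ) → sum (λ i → [ toℕ c ≡ᵇ toℕ i ] * h i) ≡ h c
sum-indicator {suc k} fzero h =
  trans (cong (h fzero + 0 +_) (sum-replicate-zero k)) (trans (+-identityʳ _) (+-identityʳ _))
sum-indicator {suc k} (fsuc c) h = sum-indicator c (h ∘ fsuc)

sum-fibres : ∀ {n k} (g : Fin n → Fin k) (h : Fin k → ℕ) →
  sum (λ s → h (g s)) ≡ sum (λ i → classSize g i * h i)
sum-fibres g h = begin
  sum (λ s → h (g s))
    ≡⟨ sum-cong-≗ (λ s → sum-indicator (g s) h) ⟨
  sum (λ s → sum λ i → [ toℕ (g s) ≡ᵇ toℕ i ] * h i)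
    ≡⟨ ∑-comm (λ s i → [ toℕ (g s) ≡ᵇ toℕ i ] * h i) ⟩
  sum (λ i → sum λ s → [ toℕ (g s) ≡ᵇ toℕ i ] * h i)
    ≡⟨ sum-cong-≗ (λ i → *-distribʳ-sum (h i) (λ s → [ toℕ (g s) ≡ᵇ toℕ i ])) ⟨
  sum (λ i → sum (λ s → [ toℕ (g s) ≡ᵇ toℕ i ]) * h i)
    ≡⟨ sum-cong-≗ (λ i → cong (_* h i) (count≡sum (λ s → toℕ (g s) ≡ᵇ toℕ i))) ⟨
  sum (λ i → classSize g i * h i) ∎
  where open ≡-Reasoning

sum-classSize : ∀ {n k} (g : Fin n → Fin k) → sum (classSize g) ≡ n
sum-classSize {n} g = begin
  sum (classSize g)                 ≡⟨ sum-cong-≗ (λ i → *-identityʳ (classSize g i)) ⟨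
  sum (λ i → classSize g i * 1)     ≡⟨ sum-fibres g (λ _ → 1) ⟨
  sum {n} (λ _ → 1)                 ≡⟨ sum-const n 1 ⟩
  n * 1                             ≡⟨ *-identityʳ n ⟩
  n                                 ∎
  where open ≡-Reasoning

module _ {n : ℕ} (R : Fin n → Fin n → Bool)
         (R-sym : ∀ a b → R a b ≡ R b a) (R-irrefl : ∀ a → R a a ≡ false) where

  private
    upper : Fin n → Fin n → ℕ
    upper a b = [ (a <ᶠ b) ∧ R a b ]

  indicator-split : ∀ a b → [ R a b ] ≡ upper a b + upper b a
  indicator-split a b with <-cmp (toℕ a) (toℕ b)
  ... | tri< a<b _ _ rewrite <ᵇ-true a<b | <ᵇ-false (<⇒≤ a<b) = sym (+-identityʳ _)
  ... | tri> _ _ b<a rewrite <ᵇ-true b<a | <ᵇ-false (<⇒≤ b<a) | R-sym b a = refl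
  ... | tri≈ _ a≡b _ rewrite toℕ-injective a≡b | R-irrefl b | <ᵇ-false {toℕ b} ≤-refl = refl

  sum-count-symmetric : sum (λ a → count (R a)) ≡ 2 * sum (λ a → count (λ b → (a <ᶠ b) ∧ R a b))
  sum-count-symmetric = begin
    sum (λ a → count (R a))
      ≡⟨ sum-cong-≗ (λ a → count≡sum (R a)) ⟩
    sum (λ a → sum λ b → [ R a b ])
      ≡⟨ sum-cong-≗ (λ a → sum-cong-≗ (indicator-split a)) ⟩
    sum (λ a → sum λ b → upper a b + upper b a)
      ≡⟨ sum-cong-≗ (λ a → ∑-distrib-+ (upper a) (λ b → upper b a)) ⟩
    sum (λ a → sum (upper a) + sum λ b → upper b a)
      ≡⟨ ∑-distrib-+ (sum ∘ upper) (λ a → sum λ b → upper b a) ⟩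
    sum (sum ∘ upper) + sum (λ a → sum λ b → upper b a)
      ≡⟨ cong (sum (sum ∘ upper) +_) (∑-comm (λ a b → upper b a)) ⟩
    sum (sum ∘ upper) + sum (sum ∘ upper)
      ≡⟨ cong (sum (sum ∘ upper) +_) (+-identityʳ _) ⟨
    2 * sum (sum ∘ upper)
      ≡⟨ cong (2 *_) (sum-cong-≗ λ a → count≡sum (λ b → (a <ᶠ b) ∧ R a b)) ⟨
    2 * sum (λ a → count (λ b → (a <ᶠ b) ∧ R a b)) ∎
    where open ≡-Reasoning

separatedPairs-identity : ∀ {n k} (g : Fin n → Fin k) →
  2 * separatedPairs g + sum (λ i → classSize g i * classSize g i) ≡ n * n
separatedPairs-identity {n} g = begin
  2 * separatedPairs g + sum (λ i → classSize g i * classSize g i)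
    ≡⟨ cong₂ _+_ (sum-count-symmetric split split-sym split-irrefl) (sum-fibres g (classSize g)) ⟨
  sum (λ s → count (split s)) + sum (λ s → classSize g (g s))
    ≡⟨ ∑-distrib-+ (count ∘ split) (λ s → classSize g (g s)) ⟨
  sum (λ s → count (split s) + classSize g (g s))
    ≡⟨ sum-cong-≗ complement ⟩
  sum {n} (λ _ → n)
    ≡⟨ sum-const n n ⟩
  n * n ∎
  where
  open ≡-Reasoning
  same : Fin n → Fin n → Bool
  same s s' = toℕ (g s) ≡ᵇ toℕ (g s')

  split : Fin n → Fin n → Bool
  split s s' = not (same s s')

  split-sym : ∀ s s' → split s s' ≡ split s' s
  split-sym s s' = cong not (≡ᵇ-sym (toℕ (g s)) (toℕ (g s')))

  split-irrefl : ∀ s → split s s ≡ false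
  split-irrefl s = cong not (det (≡ᵇ-reflects-≡ (toℕ (g s)) _) (ofʸ refl))

  complement : ∀ s → count (split s) + classSize g (g s) ≡ n
  complement s = begin
    count (split s) + classSize g (g s)
      ≡⟨ cong (count (split s) +_) (count-cong (λ s' → ≡ᵇ-sym (toℕ (g s')) (toℕ (g s)))) ⟩
    count (split s) + count (same s)
      ≡⟨ +-comm (count (split s)) _ ⟩
    count (same s) + count (split s)
      ≡⟨ count-complement (same s) ⟩
    n ∎

square-bound : ∀ a x → (2 * x + 1) * a ≤ a * a + x * (x + 1)
square-bound a x with ≤-<-connex a x
... | inj₁ a≤x with m≤n⇒∃[o]m+o≡n a≤x
...   | d , refl = begin
  (2 * (a + d) + 1) * a                ≤⟨ m≤m+n _ (d * (d + 1)) ⟩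
  (2 * (a + d) + 1) * a + d * (d + 1)  ≡⟨ solve (a ∷ d ∷ []) ⟩
  a * a + (a + d) * (a + d + 1)        ∎
  where open ≤-Reasoning
square-bound a x | inj₂ x<a with m≤n⇒∃[o]m+o≡n x<a
...   | d , refl = begin
  (2 * x + 1) * (suc x + d)                ≤⟨ m≤m+n _ (d * (d + 1)) ⟩
  (2 * x + 1) * (suc x + d) + d * (d + 1)  ≡⟨ solve (x ∷ d ∷ []) ⟩
  (suc x + d) * (suc x + d) + x * (x + 1)  ∎
  where open ≤-Reasoning

sum-classSize²-≥ : ∀ {n k} (g : Fin n → Fin k) x →
  (2 * x + 1) * n ≤ sum (λ i → classSize g i * classSize g i) + k * (x * (x + 1))
sum-classSize²-≥ {n} {k} g x = begin
  (2 * x + 1) * n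
    ≡⟨ cong ((2 * x + 1) *_) (sum-classSize g) ⟨
  (2 * x + 1) * sum (classSize g)
    ≡⟨ *-distribˡ-sum (2 * x + 1) (classSize g) ⟩
  sum (λ i → (2 * x + 1) * classSize g i)
    ≤⟨ sum-mono-≤ (λ i → square-bound (classSize g i) x) ⟩
  sum (λ i → classSize g i * classSize g i + x * (x + 1))
    ≡⟨ ∑-distrib-+ (λ i → classSize g i * classSize g i) (λ _ → x * (x + 1)) ⟩
  sum (λ i → classSize g i * classSize g i) + sum {k} (λ _ → x * (x + 1))
    ≡⟨ cong (sum (λ i → classSize g i * classSize g i) +_) (sum-const k _) ⟩
  sum (λ i → classSize g i * classSize g i) + k * (x * (x + 1)) ∎
  where open ≤-Reasoning

opposite-injective : ∀ {k} → Injective _≡_ _≡_ (opposite {k})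
opposite-injective {k} {a} {b} eq =
  trans (sym (opposite-involutive a)) (trans (cong opposite eq) (opposite-involutive b))

opposite-≡ᵇ : ∀ {k} (a b : Fin k) → (toℕ (opposite a) ≡ᵇ toℕ (opposite b)) ≡ (toℕ a ≡ᵇ toℕ b)
opposite-≡ᵇ a b = det (≡ᵇ-reflects-≡ (toℕ (opposite a)) (toℕ (opposite b)))
  (fromEquivalence (λ a≡b → cong (toℕ ∘ opposite) (toℕ-injective (≡ᵇ⇒≡ (toℕ a) (toℕ b) a≡b)))
                   (λ a′≡b′ → ≡⇒≡ᵇ (toℕ a) (toℕ b) (cong toℕ (opposite-injective (toℕ-injective a′≡b′)))))

classSize-opposite : ∀ {n k} (g : Fin n → Fin k) i → classSize (opposite ∘ g) i ≡ classSize g (opposite i)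
classSize-opposite g i = count-cong λ s → begin
  toℕ (opposite (g s)) ≡ᵇ toℕ i
    ≡⟨ cong (λ j → toℕ (opposite (g s)) ≡ᵇ toℕ j) (opposite-involutive i) ⟨
  toℕ (opposite (g s)) ≡ᵇ toℕ (opposite (opposite i)) ≡⟨ opposite-≡ᵇ (g s) (opposite i) ⟩
  toℕ (g s) ≡ᵇ toℕ (opposite i)                       ∎
  where open ≡-Reasoning

separatedPairs-opposite : ∀ {n k} (g : Fin n → Fin k) → separatedPairs (opposite ∘ g) ≡ separatedPairs g
separatedPairs-opposite g =
  sum-cong-≗ λ s → count-cong λ s' → cong (λ b → (s <ᶠ s') ∧ not b) (opposite-≡ᵇ (g s) (g s'))

count-classSize-opposite : ∀ {n k} (g : Fin n → Fin k) (P : ℕ → Bool) →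
  count (λ i → P (classSize (opposite ∘ g) i)) ≡ count (λ i → P (classSize g i))
count-classSize-opposite g P =
  trans (count-cong (cong P ∘ classSize-opposite g)) (count-opposite (P ∘ classSize g))

reversing-reflected : ∀ {n k m} (t : Tests n k m) → Reversing t → Reflected t
reversing-reflected t reversing j i = begin
  occ t (inject₁ j) i
    ≡⟨ cong (classSize (t (inject₁ j))) (opposite-involutive i) ⟨
  classSize (t (inject₁ j)) (opposite (opposite i))
    ≡⟨ classSize-opposite (t (inject₁ j)) (opposite i) ⟨
  classSize (opposite ∘ t (inject₁ j)) (opposite i)
    ≡⟨ count-cong (λ s → cong (λ c → toℕ c ≡ᵇ _) (reversing j s)) ⟨
  occ t (fsuc j) (opposite i) ∎
  where open ≡-Reasoning

opposite^ : ∀ {k} → ℕ → Fin k → Fin k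
opposite^ zero    = id
opposite^ (suc r) = opposite ∘ opposite^ r

opposite^-invariant : ∀ {n k} (F : (Fin n → Fin k) → ℕ) → (∀ g → F (opposite ∘ g) ≡ F g) →
  ∀ f r → F (opposite^ r ∘ f) ≡ F f
opposite^-invariant F invariant f zero    = refl
opposite^-invariant F invariant f (suc r) = trans (invariant (opposite^ r ∘ f)) (opposite^-invariant F invariant f r)

alternating : ∀ {n k} m → (Fin n → Fin k) → Tests n k m
alternating m f j = opposite^ (toℕ j) ∘ f

alternating-reversing : ∀ {n k} m (f : Fin n → Fin k) → Reversing (alternating m f)
alternating-reversing m f j s = cong (λ r → opposite (opposite^ r (f s))) (sym (toℕ-inject₁ j))

alternating-separatedPairs : ∀ {n k} m (f : Fin n → Fin k) j →
  separatedPairs (alternating m f j) ≡ separatedPairs f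
alternating-separatedPairs m f j = opposite^-invariant separatedPairs separatedPairs-opposite f (toℕ j)

alternating-pcr : ∀ {n k} m (f : Fin n → Fin k) → IsPcr (alternating m f) (m * separatedPairs f)
alternating-pcr m f = (greedy t , ≤-antisym upper (lower (greedy t))) , lower
  where
  t = alternating m f

  crossings-t : sum (λ j → separatedPairs (t (fsuc j))) ≡ m * separatedPairs f
  crossings-t = trans (sum-cong-≗ (alternating-separatedPairs m f ∘ fsuc)) (sum-const m _)

  lower : ∀ L → m * separatedPairs f ≤ crossings L
  lower L = subst (_≤ crossings L) crossings-t (reversing-crossings-≥ (alternating-reversing m f) L)

  upper : crossings (greedy t) ≤ m * separatedPairs f
  upper = ≤-trans (greedy-crossings-≤ t) (≤-reflexive crossings-t)

alternating-balanced : ∀ {n k} m (f : Fin n → Fin k) x y →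
  count (λ i → classSize f i ≡ᵇ x) ≡ k ∸ y × count (λ i → classSize f i ≡ᵇ suc x) ≡ y →
  Balanced (alternating m f) x y
alternating-balanced m f x y (few , many) j =
  trans (invariant (_≡ᵇ x)) few , trans (invariant (_≡ᵇ suc x)) many
  where
  invariant : ∀ P → count (λ i → P (classSize (alternating m f j) i)) ≡ count (λ i → P (classSize f i))
  invariant P = opposite^-invariant (λ g → count (λ i → P (classSize g i)))
                  (λ g → count-classSize-opposite g P) f (toℕ j)

pcr-≤-separatedPairs : ∀ {n k m} (t : Tests n k m) {c} → IsPcr t c →
  c ≤ sum (λ j → separatedPairs (t (fsuc j)))
pcr-≤-separatedPairs t (_ , minimal) = ≤-trans (minimal (greedy t)) (greedy-crossings-≤ t)

module _ {k : ℕ} where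

  blocks : ∀ x → Fin (x * k) → Fin k
  blocks zero    ()
  blocks (suc x) = [ id , blocks x ]′ ∘ splitAt k

  classSize-join : ∀ {a b} (g : Fin a → Fin k) (h : Fin b → Fin k) i →
    classSize ([ g , h ]′ ∘ splitAt a) i ≡ classSize g i + classSize h i
  classSize-join {a} {b} g h i = trans (count-↑ a _) (cong₂ _+_
    (count-cong λ s → cong (λ z → toℕ ([ g , h ]′ z) ≡ᵇ toℕ i) (splitAt-↑ˡ a s b))
    (count-cong λ s → cong (λ z → toℕ ([ g , h ]′ z) ≡ᵇ toℕ i) (splitAt-↑ʳ a b s)))

  classSize-id : ∀ i → classSize {k} id i ≡ 1
  classSize-id i = trans (count-toℕ≡ k (toℕ i)) (cong [_] (<ᵇ-true (toℕ<n i)))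

  classSize-blocks : ∀ x i → classSize (blocks x) i ≡ x
  classSize-blocks zero    i = refl
  classSize-blocks (suc x) i = trans (classSize-join id (blocks x) i)
    (cong₂ _+_ (classSize-id i) (classSize-blocks x i))

  classSize-inject≤ : ∀ {y} (y≤k : y ≤ k) i → classSize (λ r → inject≤ r y≤k) i ≡ [ toℕ i <ᵇ y ]
  classSize-inject≤ {y} y≤k i =
    trans (count-cong λ r → cong (_≡ᵇ toℕ i) (toℕ-inject≤ r y≤k)) (count-toℕ≡ y (toℕ i))

  balancedColouring : ∀ x {y} → y ≤ k → Fin (x * k + y) → Fin k
  balancedColouring x y≤k = [ blocks x , (λ r → inject≤ r y≤k) ]′ ∘ splitAt (x * k)

  classSize-balancedColouring : ∀ x {y} (y≤k : y ≤ k) i →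
    classSize (balancedColouring x y≤k) i ≡ x + [ toℕ i <ᵇ y ]
  classSize-balancedColouring x y≤k i = trans (classSize-join (blocks x) _ i)
    (cong₂ _+_ (classSize-blocks x i) (classSize-inject≤ y≤k i))

m≡n+o⇒m∸n≡o : ∀ {a} b c → a ≡ b + c → a ∸ b ≡ c
m≡n+o⇒m∸n≡o b c refl = m+n∸m≡n b c

pair-count-formula : ∀ k x y → y < k →
  k * x * (x * k + y ∸ x) + y * (x * k + y ∸ 2 * x ∸ 1) + (k * (x * x) + y * (2 * x + 1))
    ≡ (x * k + y) * (x * k + y)
pair-count-formula (suc k) x zero _
  rewrite m≡n+o⇒m∸n≡o {x * suc k + 0} x (x * k) (solve (x ∷ k ∷ [])) = solve (x ∷ k ∷ [])
pair-count-formula (suc (suc k)) x (suc y) _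
  rewrite m≡n+o⇒m∸n≡o {x * suc (suc k) + suc y} x (x * suc k + suc y) (solve (x ∷ k ∷ y ∷ []))
        | ∸-+-assoc (x * suc (suc k) + suc y) (2 * x) 1
        | m≡n+o⇒m∸n≡o {x * suc (suc k) + suc y} (2 * x + 1) (x * k + y) (solve (x ∷ k ∷ y ∷ []))
        = solve (x ∷ k ∷ y ∷ [])
pair-count-formula (suc zero) x (suc y) (s≤s ())

module BalancedColouring {k x y : ℕ} (y≤k : y ≤ k) (f : Fin (x * k + y) → Fin k)
    (classSize-f : ∀ i → classSize f i ≡ x + [ toℕ i <ᵇ y ]) where

  sum-classSize² : sum (λ i → classSize f i * classSize f i) ≡ k * (x * x) + y * (2 * x + 1)
  sum-classSize² = begin
    sum (λ i → classSize f i * classSize f i)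
      ≡⟨ sum-cong-≗ (λ i → trans (cong (λ c → c * c) (classSize-f i)) (square (toℕ i <ᵇ y))) ⟩
    sum {k} (λ i → x * x + [ toℕ i <ᵇ y ] * (2 * x + 1))
      ≡⟨ ∑-distrib-+ {k} (λ _ → x * x) (λ i → [ toℕ i <ᵇ y ] * (2 * x + 1)) ⟩
    sum {k} (λ _ → x * x) + sum {k} (λ i → [ toℕ i <ᵇ y ] * (2 * x + 1))
      ≡⟨ cong₂ _+_ (sum-const k (x * x)) (sym (*-distribʳ-sum {k} (2 * x + 1) (λ i → [ toℕ i <ᵇ y ]))) ⟩
    k * (x * x) + sum {k} (λ i → [ toℕ i <ᵇ y ]) * (2 * x + 1)
      ≡⟨ cong (λ c → k * (x * x) + c * (2 * x + 1)) (trans (sym (count≡sum {k} (λ i → toℕ i <ᵇ y))) (count-toℕ< y y≤k)) ⟩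
    k * (x * x) + y * (2 * x + 1) ∎
    where
    open ≡-Reasoning
    square : ∀ b → (x + [ b ]) * (x + [ b ]) ≡ x * x + [ b ] * (2 * x + 1)
    square false = solve (x ∷ [])
    square true  = solve (x ∷ [])

  separatedPairs-maximal : ∀ (g : Fin (x * k + y) → Fin k) → separatedPairs g ≤ separatedPairs f
  separatedPairs-maximal g = *-cancelˡ-≤ 2 (+-cancelʳ-≤ (sum (λ i → classSize g i * classSize g i)) _ _ (begin
    2 * separatedPairs g + sum (λ i → classSize g i * classSize g i)
      ≡⟨ separatedPairs-identity g ⟩
    n * n
      ≡⟨ separatedPairs-identity f ⟨
    2 * separatedPairs f + sum (λ i → classSize f i * classSize f i)
      ≤⟨ +-monoʳ-≤ (2 * separatedPairs f) squares-f≤g ⟩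
    2 * separatedPairs f + sum (λ i → classSize g i * classSize g i) ∎))
    where
    open ≤-Reasoning
    n = x * k + y
    squares-f≤g : sum (λ i → classSize f i * classSize f i) ≤ sum (λ i → classSize g i * classSize g i)
    squares-f≤g = +-cancelʳ-≤ (k * (x * (x + 1))) _ _ (begin
      sum (λ i → classSize f i * classSize f i) + k * (x * (x + 1))
        ≡⟨ cong (_+ k * (x * (x + 1))) sum-classSize² ⟩
      k * (x * x) + y * (2 * x + 1) + k * (x * (x + 1))  ≡⟨ solve (k ∷ x ∷ y ∷ []) ⟩
      (2 * x + 1) * (x * k + y)                           ≤⟨ sum-classSize²-≥ g x ⟩
      sum (λ i → classSize g i * classSize g i) + k * (x * (x + 1)) ∎)

  twice-separatedPairs : y < k →
    2 * separatedPairs f ≡ k * x * (x * k + y ∸ x) + y * (x * k + y ∸ 2 * x ∸ 1)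
  twice-separatedPairs y<k = +-cancelʳ-≡ (k * (x * x) + y * (2 * x + 1)) _ _ (begin
    2 * separatedPairs f + (k * (x * x) + y * (2 * x + 1))
      ≡⟨ cong (2 * separatedPairs f +_) sum-classSize² ⟨
    2 * separatedPairs f + sum (λ i → classSize f i * classSize f i)
      ≡⟨ separatedPairs-identity f ⟩
    (x * k + y) * (x * k + y)
      ≡⟨ pair-count-formula k x y y<k ⟨
    k * x * (x * k + y ∸ x) + y * (x * k + y ∸ 2 * x ∸ 1) + (k * (x * x) + y * (2 * x + 1)) ∎)
    where open ≡-Reasoning

  count-classSize-≡ᵇ : count (λ i → classSize f i ≡ᵇ x) ≡ k ∸ y
                     × count (λ i → classSize f i ≡ᵇ suc x) ≡ y
  count-classSize-≡ᵇ =
      trans (count-cong (λ i → trans (cong (_≡ᵇ x) (classSize-f i)) (small (toℕ i <ᵇ y)))) small-count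
    , trans (count-cong (λ i → trans (cong (_≡ᵇ suc x) (classSize-f i)) (large (toℕ i <ᵇ y))))
            (count-toℕ< y y≤k)
    where
    open ≡-Reasoning
    small : ∀ b → (x + [ b ] ≡ᵇ x) ≡ not b
    small false = det (≡ᵇ-reflects-≡ (x + 0) x) (ofʸ (+-identityʳ x))
    small true  = det (≡ᵇ-reflects-≡ (x + 1) x) (ofⁿ (m+1+n≢m x))

    large : ∀ b → (x + [ b ] ≡ᵇ suc x) ≡ b
    large false = det (≡ᵇ-reflects-≡ (x + 0) (suc x)) (ofⁿ (λ eq → 1+n≢n (trans (sym eq) (+-identityʳ x))))
    large true  = det (≡ᵇ-reflects-≡ (x + 1) (suc x)) (ofʸ (+-comm x 1))

    small-count : count {k} (λ i → not (toℕ i <ᵇ y)) ≡ k ∸ y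
    small-count = sym (begin
      k ∸ y
        ≡⟨ cong (_∸ y) (count-complement below) ⟨
      count below + count (not ∘ below) ∸ y
        ≡⟨ cong (λ c → c + count (not ∘ below) ∸ y) (count-toℕ< y y≤k) ⟩
      y + count (not ∘ below) ∸ y
        ≡⟨ m+n∸m≡n y _ ⟩
      count (not ∘ below) ∎)
      where
      below : Fin k → Bool
      below i = toℕ i <ᵇ y

-- 1 ≤ k follows from y < k, and the statement holds for m = 0 as well.
theorem4 : ∀ (n k m x y : ℕ) → 1 ≤ k → 1 ≤ m → n ≡ x * k + y → y < k →
    ∃[ e ] ((2 * e ≡ m * (k * x * (n ∸ x) + y * (n ∸ 2 * x ∸ 1)))
    × IsEcr n k m e
    × Σ (Tests n k m) (λ t → IsPcr t e × Balanced t x y × Reflected t))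
theorem4 .(x * k + y) k m x y _ _ refl y<k =
  m * separatedPairs f , twice-e , ((t , alternating-pcr m f) , pcr≤e) ,
  (t , alternating-pcr m f , alternating-balanced m f x y count-classSize-≡ᵇ ,
   reversing-reflected t (alternating-reversing m f))
  where
  f = balancedColouring x (<⇒≤ y<k)
  open BalancedColouring (<⇒≤ y<k) f (classSize-balancedColouring x (<⇒≤ y<k))
  t = alternating m f

  pcr≤e : ∀ t′ c → IsPcr t′ c → c ≤ m * separatedPairs f
  pcr≤e t′ c pcr = begin
    c                                          ≤⟨ pcr-≤-separatedPairs t′ pcr ⟩
    sum (λ j → separatedPairs (t′ (fsuc j)))   ≤⟨ sum-mono-≤ (separatedPairs-maximal ∘ t′ ∘ fsuc) ⟩
    sum {m} (λ _ → separatedPairs f)           ≡⟨ sum-const m _ ⟩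
    m * separatedPairs f                       ∎
    where open ≤-Reasoning

  twice-e : 2 * (m * separatedPairs f) ≡ m * (k * x * (x * k + y ∸ x) + y * (x * k + y ∸ 2 * x ∸ 1))
  twice-e = trans (x∙yz≈y∙xz 2 m (separatedPairs f)) (cong (m *_) (twice-separatedPairs y<k))
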